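{- Let $G$ be a linear algebraic group over a field $F$, let $\theta_1,\theta_2$ be commuting involutive automorphisms of $G$, and let $H_1$ be the subgroup of $G$ fixed by $\theta_1$. Let $\gamma\in G(F)$ satisfy $\gamma\theta_2(\gamma)=1$, and put $\delta=\gamma\,\theta_1\theta_2(\gamma)=\gamma\theta_1(\gamma)^{ -1}$. Then: (1) $\gamma$ commutes with $\theta_1\theta_2(\gamma)$ if and only if $\theta_1\theta_2(\delta)=\delta$; (2) if $\gamma$ commutes with $\theta_1\theta_2(\gamma)$ and the centralizer $C_G(\delta)$ is a torus, then every $h\in H_1(F)$ with $h^{ -1}\gamma\theta_2(h)=\gamma$ satisfies $\theta_2(h)=h$.
   Context: An element $\gamma$ with $\gamma\theta_2(\gamma)=1$ is called $\theta_1\theta_2$-normal if it commutes with $\theta_1\theta_2(\gamma)$; $H_1$ acts on such elements by $\gamma\cdot h=h^{ -1}\gamma\theta_2(h)$, and (2) says the stabilizer of a normal $\gamma$ is contained in the $\theta_2$-fixed points of $H_1$. -}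

module Defs where

open import Level using (Level; _⊔_; suc)
open import Algebra.Bundles using (Group)
open import Data.Product using (_×_)
open import Relation.Unary using (Pred)

-- Setting: G(F) is modelled as an abstract group (setoid equality _≈_).
module _ {c ℓ : Level} (G : Group c ℓ) where
  open Group G

  record IsInvolutiveAut (θ : Carrier → Carrier) : Set (c ⊔ ℓ) where
    field
      θ-cong   : ∀ {x y} → x ≈ y → θ x ≈ θ y
      θ-hom    : ∀ x y → θ (x ∙ y) ≈ θ x ∙ θ y
      θ-invol  : ∀ x → θ (θ x) ≈ x

  Commute : (θ₁ θ₂ : Carrier → Carrier) → Set (c ⊔ ℓ)
  Commute θ₁ θ₂ = ∀ x → θ₁ (θ₂ x) ≈ θ₂ (θ₁ x)

  Fixed : (θ : Carrier → Carrier) → Pred Carrier ℓ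
  Fixed θ h = θ h ≈ h

  Centralizer : Carrier → Pred Carrier ℓ
  Centralizer δ x = x ∙ δ ≈ δ ∙ x

  -- a predicate on subgroups ("is a torus"), abstracted; the only property of tori
  -- we record is that a torus is commutative.
  record TorusNotion (t : Level) : Set (c ⊔ suc ℓ ⊔ suc t) where
    field
      IsTorus : Pred Carrier ℓ → Set t
      torus-comm : ∀ S → IsTorus S → ∀ x y → S x → S y → x ∙ y ≈ y ∙ x

-- Write σ = θ₁θ₂. Since σ is an involutive automorphism, σ(γ σ(γ)) = σ(γ) γ, which gives (1).
-- For (2), the equation h⁻¹ γ θ₂(h) = γ says γ intertwines θ₂(h) with h; applying θ₁ shows that
-- θ₁(γ) does too, hence h commutes with γ θ₁(γ)⁻¹ = δ. When γ is normal it also commutes with δ,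
-- so h and γ both lie in the torus C_G(δ) and commute; then γ θ₂(h) = h γ = γ h, and θ₂(h) = h.
module Submission where

open import Defs
open import Level using (Level)
open import Algebra.Bundles using (Group)
open import Data.Product using (_×_; _,_)
open import Function.Base using (_∘_)
open import Function.Bundles using (_⇔_; mk⇔)
import Algebra.Properties.Group as GroupProperties
import Algebra.Properties.Monoid as MonoidProperties
import Relation.Binary.Reasoning.Setoid as SetoidReasoning

module GroupLemmas {c ℓ : Level} (G : Group c ℓ) where
  open Group G
  open GroupProperties G
  open MonoidProperties monoid using (cancelʳ; insertˡ)
  open SetoidReasoning setoid

  Intertwines : Carrier → Carrier → Carrier → Set ℓ
  Intertwines x k h = x ∙ k ≈ h ∙ x

  intertwines-resp : ∀ {x k k′ h h′} → k ≈ k′ → h ≈ h′ →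
                     Intertwines x k h → Intertwines x k′ h′
  intertwines-resp k≈k′ h≈h′ xk≈hx = trans (∙-congˡ (sym k≈k′)) (trans xk≈hx (∙-congʳ h≈h′))

  twisted-fixed⇒intertwines : ∀ {γ k h} → (h ⁻¹ ∙ γ) ∙ k ≈ γ → Intertwines γ k h
  twisted-fixed⇒intertwines {γ} {k} {h} fixed = begin
    γ ∙ k               ≈⟨ insertˡ (inverseʳ h) (γ ∙ k) ⟩
    h ∙ (h ⁻¹ ∙ (γ ∙ k)) ≈⟨ ∙-congˡ (assoc (h ⁻¹) γ k) ⟨
    h ∙ ((h ⁻¹ ∙ γ) ∙ k) ≈⟨ ∙-congˡ fixed ⟩
    h ∙ γ               ∎

  intertwines-inverse : ∀ {a k h} → Intertwines a k h → Intertwines (a ⁻¹) h k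
  intertwines-inverse {a} {k} {h} ak≈ha = sym (∙-cancelˡ a (k ∙ a ⁻¹) (a ⁻¹ ∙ h) (begin
    a ∙ (k ∙ a ⁻¹)  ≈⟨ assoc a k (a ⁻¹) ⟨
    (a ∙ k) ∙ a ⁻¹  ≈⟨ ∙-congʳ ak≈ha ⟩
    (h ∙ a) ∙ a ⁻¹  ≈⟨ cancelʳ (inverseʳ a) h ⟩
    h               ≈⟨ insertˡ (inverseʳ a) h ⟩
    a ∙ (a ⁻¹ ∙ h)  ∎))

  intertwiners-quotient-centralizes : ∀ {γ a k h} → Intertwines γ k h → Intertwines a k h →
                                      Centralizer G (γ ∙ a ⁻¹) h
  intertwiners-quotient-centralizes {γ} {a} {k} {h} γk≈hγ ak≈ha = sym (begin
    (γ ∙ a ⁻¹) ∙ h  ≈⟨ assoc γ (a ⁻¹) h ⟩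
    γ ∙ (a ⁻¹ ∙ h)  ≈⟨ ∙-congˡ (intertwines-inverse ak≈ha) ⟩
    γ ∙ (k ∙ a ⁻¹)  ≈⟨ assoc γ k (a ⁻¹) ⟨
    (γ ∙ k) ∙ a ⁻¹  ≈⟨ ∙-congʳ γk≈hγ ⟩
    (h ∙ γ) ∙ a ⁻¹  ≈⟨ assoc h γ (a ⁻¹) ⟩
    h ∙ (γ ∙ a ⁻¹)  ∎)

  centralizer-resp : ∀ {x y h} → x ≈ y → Centralizer G y h → Centralizer G x h
  centralizer-resp x≈y hy≈yh = trans (∙-congˡ x≈y) (trans hy≈yh (∙-congʳ (sym x≈y)))

  commute⇒centralizes-product : ∀ {x y} → x ∙ y ≈ y ∙ x → Centralizer G (x ∙ y) x
  commute⇒centralizes-product {x} {y} xy≈yx = begin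
    x ∙ (x ∙ y)  ≈⟨ ∙-congˡ xy≈yx ⟩
    x ∙ (y ∙ x)  ≈⟨ assoc x y x ⟨
    (x ∙ y) ∙ x  ∎

  module InvolutiveAut {θ : Carrier → Carrier} (θ-aut : IsInvolutiveAut G θ) where
    open IsInvolutiveAut θ-aut public

    θ-ε : θ ε ≈ ε
    θ-ε = identityˡ-unique (θ ε) (θ ε) (trans (sym (θ-hom ε ε)) (θ-cong (identityˡ ε)))

    θ-⁻¹ : ∀ x → θ (x ⁻¹) ≈ θ x ⁻¹
    θ-⁻¹ x = inverseˡ-unique (θ (x ⁻¹)) (θ x)
      (trans (sym (θ-hom (x ⁻¹) x)) (trans (θ-cong (inverseˡ x)) θ-ε))

    θ-intertwines : ∀ {x k h} → Intertwines x k h → Intertwines (θ x) (θ k) (θ h)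
    θ-intertwines {x} {k} {h} xk≈hx = begin
      θ x ∙ θ k  ≈⟨ θ-hom x k ⟨
      θ (x ∙ k)  ≈⟨ θ-cong xk≈hx ⟩
      θ (h ∙ x)  ≈⟨ θ-hom h x ⟩
      θ h ∙ θ x  ∎

    θ-product-with-image : ∀ x → θ (x ∙ θ x) ≈ θ x ∙ x
    θ-product-with-image x = trans (θ-hom x (θ x)) (∙-congˡ (θ-invol x))

    commutes-with-image⇔fixes-product : ∀ x →
      (x ∙ θ x ≈ θ x ∙ x) ⇔ (θ (x ∙ θ x) ≈ x ∙ θ x)
    commutes-with-image⇔fixes-product x = mk⇔
      (λ comm → trans (θ-product-with-image x) (sym comm))
      (λ fixed → trans (sym fixed) (θ-product-with-image x))

  ∘-isInvolutiveAut : ∀ {θ₁ θ₂} → IsInvolutiveAut G θ₁ → IsInvolutiveAut G θ₂ →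
                      Commute G θ₁ θ₂ → IsInvolutiveAut G (θ₁ ∘ θ₂)
  ∘-isInvolutiveAut {θ₁} {θ₂} θ₁-aut θ₂-aut θ₁θ₂≈θ₂θ₁ = record
    { θ-cong  = θ₁.θ-cong ∘ θ₂.θ-cong
    ; θ-hom   = λ x y → trans (θ₁.θ-cong (θ₂.θ-hom x y)) (θ₁.θ-hom (θ₂ x) (θ₂ y))
    ; θ-invol = λ x → begin
        θ₁ (θ₂ (θ₁ (θ₂ x)))  ≈⟨ θ₁.θ-cong (θ₁θ₂≈θ₂θ₁ (θ₂ x)) ⟨
        θ₁ (θ₁ (θ₂ (θ₂ x)))  ≈⟨ θ₁.θ-invol (θ₂ (θ₂ x)) ⟩
        θ₂ (θ₂ x)            ≈⟨ θ₂.θ-invol x ⟩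
        x                    ∎
    }
    where
    module θ₁ = IsInvolutiveAut θ₁-aut
    module θ₂ = IsInvolutiveAut θ₂-aut

  stabilizer-of-normal-⊆-fixed : ∀ {t} (T : TorusNotion G t) {θ₁ θ₂} →
    IsInvolutiveAut G θ₁ → IsInvolutiveAut G θ₂ → Commute G θ₁ θ₂ →
    ∀ {γ} → γ ∙ θ₂ γ ≈ ε → γ ∙ θ₁ (θ₂ γ) ≈ θ₁ (θ₂ γ) ∙ γ →
    TorusNotion.IsTorus T (Centralizer G (γ ∙ θ₁ (θ₂ γ))) →
    ∀ h → Fixed G θ₁ h → (h ⁻¹ ∙ γ) ∙ θ₂ h ≈ γ → θ₂ h ≈ h
  stabilizer-of-normal-⊆-fixed T {θ₁} {θ₂} θ₁-aut θ₂-aut θ₁θ₂≈θ₂θ₁ {γ} γθ₂γ≈ε normal torus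
                               h θ₁h≈h twisted-fixed =
    ∙-cancelˡ γ (θ₂ h) h (trans γ-intertwines hγ≈γh)
    where
    module θ₁ = InvolutiveAut θ₁-aut
    module θ₂ = IsInvolutiveAut θ₂-aut

    γ-intertwines : Intertwines γ (θ₂ h) h
    γ-intertwines = twisted-fixed⇒intertwines twisted-fixed

    θ₁γ-intertwines : Intertwines (θ₁ γ) (θ₂ h) h
    θ₁γ-intertwines = intertwines-resp (trans (θ₁θ₂≈θ₂θ₁ h) (θ₂.θ-cong θ₁h≈h)) θ₁h≈h
                                       (θ₁.θ-intertwines γ-intertwines)

    σγ≈θ₁γ⁻¹ : θ₁ (θ₂ γ) ≈ θ₁ γ ⁻¹
    σγ≈θ₁γ⁻¹ = trans (θ₁.θ-cong (inverseʳ-unique γ (θ₂ γ) γθ₂γ≈ε)) (θ₁.θ-⁻¹ γ)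

    h∈C[δ] : Centralizer G (γ ∙ θ₁ (θ₂ γ)) h
    h∈C[δ] = centralizer-resp (∙-congˡ σγ≈θ₁γ⁻¹)
               (intertwiners-quotient-centralizes γ-intertwines θ₁γ-intertwines)

    hγ≈γh : h ∙ γ ≈ γ ∙ h
    hγ≈γh = TorusNotion.torus-comm T _ torus h γ h∈C[δ] (commute⇒centralizes-product normal)

lemma2p3 : ∀ {c ℓ t : Level} (G : Group c ℓ) (T : TorusNotion G t)
    (θ₁ θ₂ : Group.Carrier G → Group.Carrier G) →
    IsInvolutiveAut G θ₁ → IsInvolutiveAut G θ₂ → Commute G θ₁ θ₂ →
    (γ : Group.Carrier G) → Group._≈_ G (Group._∙_ G γ (θ₂ γ)) (Group.ε G) →
    let open Group G
        δ = γ ∙ θ₁ (θ₂ γ)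
    in ((γ ∙ θ₁ (θ₂ γ) ≈ θ₁ (θ₂ γ) ∙ γ) ⇔ (θ₁ (θ₂ δ) ≈ δ))
       × ((γ ∙ θ₁ (θ₂ γ) ≈ θ₁ (θ₂ γ) ∙ γ) → TorusNotion.IsTorus T (Centralizer G δ) →
          ∀ h → Fixed G θ₁ h → (h ⁻¹ ∙ γ) ∙ θ₂ h ≈ γ → θ₂ h ≈ h)
lemma2p3 G T θ₁ θ₂ θ₁-aut θ₂-aut θ₁θ₂≈θ₂θ₁ γ γθ₂γ≈ε =
    InvolutiveAut.commutes-with-image⇔fixes-product σ-aut γ
  , stabilizer-of-normal-⊆-fixed T θ₁-aut θ₂-aut θ₁θ₂≈θ₂θ₁ γθ₂γ≈ε
  where
  open GroupLemmas G
  σ-aut : IsInvolutiveAut G (θ₁ ∘ θ₂)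
  σ-aut = ∘-isInvolutiveAut θ₁-aut θ₂-aut θ₁θ₂≈θ₂θ₁
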